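{- (a) $Q_3^{(2)}\in\mathscr{C}_0$, and $Q_3(s_1,\dots,s_8)\in\mathscr{C}_0\cup\mathscr{C}_1$ for all integers $s_1,\dots,s_8\ge 2$. (b) For every $\lambda\ge 4$, $Q_\lambda(s_1,\dots,s_n)\in\mathscr{C}_0$ for all integers $s_1,\dots,s_n\ge 2$, where $n=2^\lambda$.
   Context: $Q_\lambda=K_2\times K_2\times\dots\times K_2$ ($\lambda$ factors) is the hypercube graph, where $\times$ is the cartesian product: $G\times H$ has vertex set $V(G)\times V(H)$ and $\langle u,x\rangle\langle v,y\rangle$ is an edge iff either $u=v$ and $xy\in E(H)$, or $uv\in E(G)$ and $x=y$. For a graph $G$ with vertex set $\{v_1,\dots,v_n\}$ and positive integers $s_1,\dots,s_n$, the vertex-multiplication $G(s_1,\dots,s_n)$ is the graph whose vertex set is a disjoint union $V_1\cup\dots\cup V_n$ with $|V_i|=s_i$, where $u\in V_i$ and $v\in V_j$ are adjacent iff $i\ne j$ and $v_iv_j\in E(G)$; $G^{(s)}=G(s,\dots,s)$. For a connected bridgeless graph $X$, $\bar d(X)$ is the minimum diameter of a strong orientation of $X$. For $j\in\{0,1,2\}$, $\mathscr{C}_j$ is the class of all vertex-multiplications $G(s_1,\dots,s_n)$ of a connected graph $G$ with all $s_i\ge 2$ such that $\bar d(G(s_1,\dots,s_n))=d(G)+j$, $d(G)$ being the diameter of $G$. -}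

module Defs where

open import Data.Nat using (ℕ; zero; suc; _+_; _≤_)
open import Data.Fin using (Fin)
open import Data.Bool using (Bool)
open import Data.Unit using (⊤)
open import Data.Empty using (⊥)
open import Data.Product using (Σ; _×_; _,_)
open import Data.Sum using (_⊎_)
open import Relation.Nullary using (¬_)
open import Relation.Binary.PropositionalEquality using (_≡_; _≢_)

record Graph : Set₁ where
  field
    V : Set
    E : V → V → Set
open Graph public

K₁ : Graph
K₁ = record { V = ⊤ ; E = λ _ _ → ⊥ }

K₂ : Graph
K₂ = record { V = Bool ; E = λ x y → x ≢ y }

_□_ : Graph → Graph → Graph
G □ H = record
  { V = V G × V H
  ; E = λ { (u , x) (v , y) → (u ≡ v × E H x y) ⊎ (E G u v × x ≡ y) } }

Q : ℕ → Graph
Q zero    = K₁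
Q (suc l) = K₂ □ Q l

mult : (G : Graph) → (V G → ℕ) → Graph
mult G s = record
  { V = Σ (V G) (λ v → Fin (s v))
  ; E = λ { (v , a) (w , b) → (v ≢ w) × E G v w } }

-- Walks of length at most k following relation R (directed in general).
data Walk {A : Set} (R : A → A → Set) : ℕ → A → A → Set where
  here : ∀ {k u} → Walk R k u u
  step : ∀ {k u w v} → R u w → Walk R k w v → Walk R (suc k) u v

DiamLE : {A : Set} → (A → A → Set) → ℕ → Set
DiamLE R k = ∀ u v → Walk R k u v

IsDiam : {A : Set} → (A → A → Set) → ℕ → Set
IsDiam R k = DiamLE R k × (∀ m → DiamLE R m → k ≤ m)

IsDiameter : Graph → ℕ → Set
IsDiameter G d = IsDiam (E G) d

IsOrientation : (G : Graph) → (V G → V G → Set) → Set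
IsOrientation G O =
  (∀ u v → O u v → E G u v) ×
  (∀ u v → E G u v → O u v ⊎ O v u) ×
  (∀ u v → ¬ (O u v × O v u))

-- d̄(G) = k : minimum diameter of a strong orientation of G is k.
-- (A strong orientation is one with finite diameter, i.e. DiamLE O m for some m.)
MinOrientDiam : Graph → ℕ → Set₁
MinOrientDiam G k =
  Σ (V G → V G → Set) (λ O → IsOrientation G O × DiamLE O k) ×
  (∀ (O : V G → V G → Set) → IsOrientation G O → ∀ m → DiamLE O m → k ≤ m)

InClass : ℕ → (G : Graph) → (V G → ℕ) → Set₁
InClass j G s =
  (∀ v → 2 ≤ s v) ×
  Σ ℕ (λ d → IsDiameter G d × MinOrientDiam (mult G s) (d + j))

-- Projecting each class V_v of G(s) onto v maps arcs of an orientation to edges of G, so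
-- d̄(G(s)) ≥ d(G). Conversely, let D orient G⁽²⁾ so that any two vertices are joined by a walk of
-- length ≤ k and every vertex lies on a closed walk of length ≤ k. Pulling D back along a map
-- G(s) → G⁽²⁾ sending V_v onto the two twins over v orients G(s) with diameter ≤ k, because a
-- nonempty walk of D lifts to a walk between any preimages of its ends. A computer-checked
-- orientation of Q₃⁽²⁾ has diameter 3 and closed walks of length ≤ 4, so d̄(Q₃(s)) ∈ {3, 4};
-- which value occurs is decided by a finite search over all orientations. Doubling an
-- orientation of G⁽²⁾ of diameter k to (K₂ × G)⁽²⁾, with the four twins over each x in the
-- two copies forming a directed 4-cycle, gives diameter k + 1 and closed walks of length 4;
-- from Q₃ this gives orientations of Q_λ⁽²⁾ of diameter λ for λ ≥ 4 that lift to every Q_λ(s).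

module Submission where

open import Defs
open import Data.Nat using (ℕ; zero; suc; _+_; _*_; _≤_; _≤?_; _≡ᵇ_; s≤s)
open import Data.Nat.Properties using (≤-refl; +-suc; +-comm; +-identityʳ; m≤m+n; m≤n+m; n≤1+n; ≰⇒>)
open import Data.Fin using (Fin; zero; suc; toℕ; splitAt; join)
open import Data.Fin.Properties using (all?; any?; splitAt-join)
import Data.Fin as Fin
open import Data.Bool using (Bool; true; false; T; _∧_)
import Data.Bool as Bool
open import Data.Unit using (⊤; tt)
open import Data.Empty using (⊥-elim)
open import Data.Product using (Σ; ∃; ∃-syntax; _×_; _,_; proj₁; proj₂)
open import Data.Sum using (_⊎_; inj₁; inj₂)
import Data.Sum as Sum
open import Data.List using (List; []; _∷_)
open import Data.Bool.ListAction using (any)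
open import Data.Vec using (Vec; []; _∷_; lookup; tabulate)
open import Data.Vec.Properties using (lookup∘tabulate)
open import Function using (_on_; _∘_; id)
open import Relation.Binary.Core using (_⇒_)
open import Relation.Binary.Definitions using (Decidable; DecidableEquality)
open import Relation.Binary.PropositionalEquality using (_≡_; _≢_; refl; sym; trans; cong; cong₂; subst; subst₂)
open import Relation.Nullary using (Dec; yes; no; ¬_)
open import Relation.Nullary.Decidable using (_×-dec_; _⊎-dec_; _→-dec_; ¬?; map′; isYes; toWitness; fromWitness)
import Relation.Unary as U

private
  variable
    A B : Set
    k m : ℕ

record Finite (A : Set) : Set where
  field
    size       : ℕ
    enum       : Fin size → A
    index      : A → Fin size
    enum-index : ∀ a → enum (index a) ≡ a
open Finite

finite-retract : Finite A → (f : A → B) (g : B → A) → (∀ b → f (g b) ≡ b) → Finite B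
finite-retract FA f g fg = record
  { size = size FA ; enum = f ∘ enum FA ; index = index FA ∘ g
  ; enum-index = λ b → trans (cong f (enum-index FA (g b))) (fg b) }

finite-Fin : ∀ n → Finite (Fin n)
finite-Fin n = record { size = n ; enum = λ i → i ; index = λ i → i ; enum-index = λ _ → refl }

finite-⊤ : Finite ⊤
finite-⊤ = finite-retract (finite-Fin 1) (λ _ → tt) (λ _ → zero) (λ _ → refl)

finite-Bool : Finite Bool
finite-Bool = finite-retract (finite-Fin 2) toBool fromBool toBool-fromBool
  where
  toBool : Fin 2 → Bool
  toBool zero    = false
  toBool (suc _) = true
  fromBool : Bool → Fin 2
  fromBool false = zero
  fromBool true  = suc zero
  toBool-fromBool : ∀ b → toBool (fromBool b) ≡ b
  toBool-fromBool false = refl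
  toBool-fromBool true  = refl

finite-⊎ : Finite A → Finite B → Finite (A ⊎ B)
finite-⊎ FA FB = finite-retract (finite-Fin (size FA + size FB))
  (Sum.map (enum FA) (enum FB) ∘ splitAt (size FA))
  (join (size FA) (size FB) ∘ Sum.map (index FA) (index FB))
  enum-index-⊎
  where
  enum-index-⊎ : ∀ x → Sum.map (enum FA) (enum FB) (splitAt (size FA) (join (size FA) (size FB)
                   (Sum.map (index FA) (index FB) x))) ≡ x
  enum-index-⊎ x rewrite splitAt-join (size FA) (size FB) (Sum.map (index FA) (index FB) x) with x
  ... | inj₁ a = cong inj₁ (enum-index FA a)
  ... | inj₂ b = cong inj₂ (enum-index FB b)

finite-Σ-Fin : ∀ n {B : Fin n → Set} → (∀ i → Finite (B i)) → Finite (Σ (Fin n) B)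
finite-Σ-Fin zero    FB = record
  { size = 0 ; enum = λ () ; index = λ { (() , _) } ; enum-index = λ { (() , _) } }
finite-Σ-Fin (suc n) {B} FB =
  finite-retract (finite-⊎ (FB zero) (finite-Σ-Fin n (FB ∘ suc))) cons uncons cons-uncons
  where
  cons : B zero ⊎ Σ (Fin n) (B ∘ suc) → Σ (Fin (suc n)) B
  cons (inj₁ b)       = zero , b
  cons (inj₂ (i , b)) = suc i , b
  uncons : Σ (Fin (suc n)) B → B zero ⊎ Σ (Fin n) (B ∘ suc)
  uncons (zero  , b) = inj₁ b
  uncons (suc i , b) = inj₂ (i , b)
  cons-uncons : ∀ x → cons (uncons x) ≡ x
  cons-uncons (zero  , b) = refl
  cons-uncons (suc i , b) = refl

finite-Σ : {B : A → Set} → Finite A → (∀ a → Finite (B a)) → Finite (Σ A B)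
finite-Σ {B = B} FA FB =
  finite-retract (finite-Σ-Fin (size FA) (FB ∘ enum FA)) reindex unreindex reindex-unreindex
  where
  reindex : Σ (Fin (size FA)) (B ∘ enum FA) → Σ _ B
  reindex (i , b) = enum FA i , b
  unreindex : Σ _ B → Σ (Fin (size FA)) (B ∘ enum FA)
  unreindex (a , b) = index FA a , subst B (sym (enum-index FA a)) b
  transport-pair : ∀ {a a'} (e : a' ≡ a) (b : B a) → (a' , subst B (sym e) b) ≡ (a , b)
  transport-pair refl b = refl
  reindex-unreindex : ∀ x → reindex (unreindex x) ≡ x
  reindex-unreindex (a , b) = transport-pair (enum-index FA a) b

Searchable : Set → Set₁
Searchable A = ∀ {P : A → Set} → U.Decidable P → Dec (∃ P)

∃? : Finite A → Searchable A
∃? FA {P} P? = map′ (λ (i , p) → enum FA i , p)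
  (λ (a , p) → index FA a , subst P (sym (enum-index FA a)) p)
  (any? (P? ∘ enum FA))

∀? : Finite A → {P : A → Set} → U.Decidable P → Dec (∀ a → P a)
∀? FA {P} P? = map′ (λ p a → subst P (enum-index FA a) (p (index FA a)))
  (λ p i → p (enum FA i))
  (all? (P? ∘ enum FA))

finite⇒≟ : Finite A → DecidableEquality A
finite⇒≟ FA a b = map′
  (λ e → trans (sym (enum-index FA a)) (trans (cong (enum FA) e) (enum-index FA b)))
  (cong (index FA))
  (index FA a Fin.≟ index FA b)

searchable-Vec : Searchable A → ∀ m → Searchable (Vec A m)
searchable-Vec ∃A? zero    P? = map′ (λ p → [] , p) (λ { ([] , p) → p }) (P? [])
searchable-Vec ∃A? (suc m) P? = map′
  (λ (a , as , p) → a ∷ as , p)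
  (λ { (a ∷ as , p) → a , as , p })
  (∃A? (λ a → searchable-Vec ∃A? m (λ as → P? (a ∷ as))))

walk-≤ : {R : A → A → Set} {u v : A} → k ≤ m → Walk R k u v → Walk R m u v
walk-≤ _       here       = here
walk-≤ (s≤s p) (step r w) = step r (walk-≤ p w)

walk-map : {R : A → A → Set} {S : B → B → Set} (f : A → B) →
           (∀ {u v} → R u v → S (f u) (f v)) → {u v : A} → Walk R k u v → Walk S k (f u) (f v)
walk-map f g here       = here
walk-map f g (step r w) = step (g r) (walk-map f g w)

walk? : {R : A → A → Set} → Finite A → Decidable R → ∀ k → Decidable (Walk R k)
walk? FA R? zero    u v = map′ (λ { refl → here }) (λ { here → refl }) (finite⇒≟ FA u v)
walk? FA R? (suc k) u v with finite⇒≟ FA u v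
... | yes refl = yes here
... | no u≢v = map′ (λ (w , r , p) → step r p)
  (λ { here → ⊥-elim (u≢v refl) ; (step r p) → _ , r , p })
  (∃? FA (λ w → R? u w ×-dec walk? FA R? k w v))

diamLE? : {R : A → A → Set} → Finite A → Decidable R → ∀ k → Dec (DiamLE R k)
diamLE? FA R? k = ∀? FA (λ u → ∀? FA (walk? FA R? k u))

ReturnsWithin : (A → A → Set) → ℕ → Set
ReturnsWithin {A} R m = ∀ x → ∃[ z ] (R x z × Walk R m z x)

returnsWithin? : {R : A → A → Set} → Finite A → Decidable R → ∀ m → Dec (ReturnsWithin R m)
returnsWithin? FA R? m = ∀? FA (λ x → ∃? FA (λ z → R? x z ×-dec walk? FA R? m z x))

returnsWithin-≤ : {R : A → A → Set} → k ≤ m → ReturnsWithin R k → ReturnsWithin R m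
returnsWithin-≤ k≤m ret x = let (z , r , w) = ret x in z , r , walk-≤ k≤m w

walk⁺ : {R : A → A → Set} {x y : A} → ReturnsWithin R m → Walk R (suc m) x y → ∃[ z ] (R x z × Walk R m z y)
walk⁺ ret here       = ret _
walk⁺ ret (step r w) = _ , r , w

module _ {R : B → B → Set} (f : A → B) (g : B → A) (f∘g : ∀ b → f (g b) ≡ b) where

  walk-on : {u v : A} {z : B} → R (f u) z → Walk R k z (f v) → Walk (R on f) (suc k) u v
  walk-on r here = step r here
  walk-on {u = u} {z = z} r (step r′ w) =
    step (subst (R (f u)) (sym (f∘g z)) r) (walk-on (subst (λ b → R b _) (sym (f∘g z)) r′) w)

  -- Only nonempty walks lift to walks between arbitrary preimages of their ends; a pair of
  -- vertices with the same image is joined through a return walk instead.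
  diamLE-on : DiamLE R (suc m) → ReturnsWithin R m → DiamLE (R on f) (suc m)
  diamLE-on diam ret u v = let (z , r , w) = walk⁺ ret (diam (f u) (f v)) in walk-on r w

OrientationWithin : Graph → ℕ → Set₁
OrientationWithin G k = Σ (V G → V G → Set) (λ O → IsOrientation G O × DiamLE O k)

module _ {G : Graph} (E? : Decidable (E G)) where

  orientation-decidable : {O : V G → V G → Set} → IsOrientation G O → Decidable O
  orientation-decidable (arc⇒edge , edge⇒arc , antisym) u v with E? u v
  ... | no ¬e = no (¬e ∘ arc⇒edge u v)
  ... | yes e with edge⇒arc u v e
  ...   | inj₁ o  = yes o
  ...   | inj₂ o′ = no (λ o → antisym u v (o , o′))

  isOrientation? : {O : V G → V G → Set} → Finite (V G) → Decidable O → Dec (IsOrientation G O)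
  isOrientation? FV O? =
    ∀? FV (λ u → ∀? FV (λ v → O? u v →-dec E? u v)) ×-dec
    ∀? FV (λ u → ∀? FV (λ v → E? u v →-dec (O? u v ⊎-dec O? v u))) ×-dec
    ∀? FV (λ u → ∀? FV (λ v → ¬? (O? u v ×-dec O? v u)))

isOrientation-resp : {G : Graph} {O O′ : V G → V G → Set} →
                     O ⇒ O′ → O′ ⇒ O → IsOrientation G O → IsOrientation G O′
isOrientation-resp to from (arc⇒edge , edge⇒arc , antisym) =
  (λ u v → arc⇒edge u v ∘ from) ,
  (λ u v → Sum.map to to ∘ edge⇒arc u v) ,
  (λ u v (o , o′) → antisym u v (from o , from o′))

module BooleanMatrix {A : Set} (FA : Finite A) where

  Matrix : Set
  Matrix = Vec (Vec Bool (size FA)) (size FA)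

  Adj : Matrix → A → A → Set
  Adj M u v = T (lookup (lookup M (index FA u)) (index FA v))

  Adj? : ∀ M → Decidable (Adj M)
  Adj? M u v = Bool.T? _

  matrix : {R : A → A → Set} → Decidable R → Matrix
  matrix R? = tabulate (λ i → tabulate (λ j → isYes (R? (enum FA i) (enum FA j))))

  lookup-matrix : {R : A → A → Set} (R? : Decidable R) (u v : A) →
                  lookup (lookup (matrix R?) (index FA u)) (index FA v) ≡ isYes (R? u v)
  lookup-matrix R? u v = begin
    lookup (lookup (matrix R?) (index FA u)) (index FA v)
      ≡⟨ cong (λ row → lookup row (index FA v)) (lookup∘tabulate _ (index FA u)) ⟩
    lookup (tabulate (λ j → isYes (R? (enum FA (index FA u)) (enum FA j)))) (index FA v)
      ≡⟨ lookup∘tabulate _ (index FA v) ⟩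
    isYes (R? (enum FA (index FA u)) (enum FA (index FA v)))
      ≡⟨ cong₂ (λ a b → isYes (R? a b)) (enum-index FA u) (enum-index FA v) ⟩
    isYes (R? u v) ∎
    where open Relation.Binary.PropositionalEquality.≡-Reasoning

  Adj-matrix⇒ : {R : A → A → Set} (R? : Decidable R) → Adj (matrix R?) ⇒ R
  Adj-matrix⇒ R? {u} {v} a = toWitness (subst T (lookup-matrix R? u v) a)

  ⇒Adj-matrix : {R : A → A → Set} (R? : Decidable R) → R ⇒ Adj (matrix R?)
  ⇒Adj-matrix R? {u} {v} r = subst T (sym (lookup-matrix R? u v)) (fromWitness r)

  searchable-Matrix : Searchable Matrix
  searchable-Matrix = searchable-Vec (searchable-Vec (∃? finite-Bool) _) _

orientationWithin? : {G : Graph} → Finite (V G) → Decidable (E G) → ∀ k → Dec (OrientationWithin G k)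
orientationWithin? {G} FV E? k = map′
  (λ (M , or , diam) → Adj M , or , diam)
  (λ (O , or , diam) → let O? = orientation-decidable E? or in
     matrix O? , isOrientation-resp (⇒Adj-matrix O?) (Adj-matrix⇒ O?) or ,
     λ u v → walk-map id (⇒Adj-matrix O?) (diam u v))
  (searchable-Matrix (λ M → isOrientation? E? FV (Adj? M) ×-dec diamLE? FV (Adj? M) k))
  where open BooleanMatrix FV

finite-Q : ∀ l → Finite (V (Q l))
finite-Q zero    = finite-⊤
finite-Q (suc l) = finite-Σ finite-Bool (λ _ → finite-Q l)

E-Q? : ∀ l → Decidable (E (Q l))
E-Q? zero    _       _       = no (λ ())
E-Q? (suc l) (b , x) (c , y) =
  ((b Bool.≟ c) ×-dec E-Q? l x y) ⊎-dec (¬? (b Bool.≟ c) ×-dec finite⇒≟ (finite-Q l) x y)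

finite-mult : {G : Graph} {s : V G → ℕ} → Finite (V G) → Finite (V (mult G s))
finite-mult {s = s} FV = finite-Σ FV (finite-Fin ∘ s)

E-mult? : {G : Graph} {s : V G → ℕ} → Finite (V G) → Decidable (E G) → Decidable (E (mult G s))
E-mult? FV E? (v , _) (w , _) = ¬? (finite⇒≟ FV v w) ×-dec E? v w

constant : Bool → ∀ l → V (Q l)
constant b zero    = tt
constant b (suc l) = b , constant b l

in-layer : ∀ l b {x y : V (Q l)} → Walk (E (Q l)) k x y → Walk (E (Q (suc l))) k (b , x) (b , y)
in-layer l b = walk-map (b ,_) (λ e → inj₁ (refl , e))

Q-diamLE : ∀ l → DiamLE (E (Q l)) l
Q-diamLE zero    x       y       = here
Q-diamLE (suc l) (b , x) (c , y) with b Bool.≟ c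
... | yes refl = walk-≤ (n≤1+n l) (in-layer l b (Q-diamLE l x y))
... | no b≢c   = step (inj₂ (b≢c , refl)) (in-layer l c (Q-diamLE l x y))

falses : ∀ l → V (Q l) → ℕ
falses zero    _           = 0
falses (suc l) (false , x) = suc (falses l x)
falses (suc l) (true  , x) = falses l x

falses-true : ∀ l → falses l (constant true l) ≡ 0
falses-true zero    = refl
falses-true (suc l) = falses-true l

falses-false : ∀ l → falses l (constant false l) ≡ l
falses-false zero    = refl
falses-false (suc l) = cong suc (falses-false l)

falses-edge : ∀ l {x y} → E (Q l) x y → falses l x ≤ suc (falses l y)
falses-edge (suc l) {false , x} (inj₁ (refl , e)) = s≤s (falses-edge l e)
falses-edge (suc l) {true  , x} (inj₁ (refl , e)) = falses-edge l e
falses-edge (suc l) {false , x} {true  , _} (inj₂ (_ , refl)) = ≤-refl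
falses-edge (suc l) {true  , x} {false , _} (inj₂ (_ , refl)) = m≤n+m _ 2
falses-edge (suc l) {false , x} {false , _} (inj₂ (b≢c , _)) = ⊥-elim (b≢c refl)
falses-edge (suc l) {true  , x} {true  , _} (inj₂ (b≢c , _)) = ⊥-elim (b≢c refl)

falses-walk : ∀ l {x y} → Walk (E (Q l)) k x y → falses l x ≤ falses l y + k
falses-walk l here = m≤m+n _ _
falses-walk l {x} {y} (step {k = k} {w = w} e p) = begin
  falses l x             ≤⟨ falses-edge l e ⟩
  suc (falses l w)       ≤⟨ s≤s (falses-walk l p) ⟩
  suc (falses l y + k)   ≡⟨ +-suc (falses l y) k ⟨
  falses l y + suc k     ∎
  where open Data.Nat.Properties.≤-Reasoning

Q-diamLE⇒≤ : ∀ l → DiamLE (E (Q l)) m → l ≤ m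
Q-diamLE⇒≤ {m} l diam = subst₂ _≤_ (falses-false l) (cong (_+ m) (falses-true l))
  (falses-walk l (diam (constant false l) (constant true l)))

Q-isDiameter : ∀ l → IsDiameter (Q l) l
Q-isDiameter l = Q-diamLE l , λ m → Q-diamLE⇒≤ l

diamLE-mult⇒diamLE : {G : Graph} {s : V G → ℕ} {O : V (mult G s) → V (mult G s) → Set} →
  (∀ v → Fin (s v)) → IsOrientation (mult G s) O → DiamLE O m → DiamLE (E G) m
diamLE-mult⇒diamLE pick (arc⇒edge , _) diam x y =
  walk-map proj₁ (λ {u} {v} o → proj₂ (arc⇒edge u v o)) (diam (x , pick x) (y , pick y))

diameter≤orientation : {G : Graph} {s : V G → ℕ} {d : ℕ} → IsDiameter G d → (∀ v → 2 ≤ s v) →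
  ∀ O → IsOrientation (mult G s) O → ∀ m → DiamLE O m → d ≤ m
diameter≤orientation (_ , minimal) s≥2 O or m diam =
  minimal m (diamLE-mult⇒diamLE (λ v → Fin.fromℕ< (s≥2 v)) or diam)

inClass₀ : {G : Graph} {s : V G → ℕ} {d : ℕ} → IsDiameter G d → (∀ v → 2 ≤ s v) →
  OrientationWithin (mult G s) d → InClass 0 G s
inClass₀ {G} {s} {d} isDiam s≥2 orient = s≥2 , d , isDiam ,
  subst (MinOrientDiam (mult G s)) (sym (+-identityʳ d)) (orient , diameter≤orientation isDiam s≥2)

inClass₀⊎inClass₁ : {G : Graph} {s : V G → ℕ} {d : ℕ} → Finite (V G) → Decidable (E G) →
  IsDiameter G d → (∀ v → 2 ≤ s v) → OrientationWithin (mult G s) (suc d) →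
  InClass 0 G s ⊎ InClass 1 G s
inClass₀⊎inClass₁ {G} {s} {d} FV E? isDiam s≥2 orient
  with orientationWithin? {mult G s} (finite-mult {G} FV) (E-mult? {G} FV E?) d
... | yes orient₀ = inj₁ (inClass₀ isDiam s≥2 orient₀)
... | no ¬orient₀ = inj₂ (s≥2 , d , isDiam ,
  subst (MinOrientDiam (mult G s)) (+-comm 1 d) (orient , beyond))
  where
  beyond : ∀ O → IsOrientation (mult G s) O → ∀ m → DiamLE O m → suc d ≤ m
  beyond O or m diam with m ≤? d
  ... | yes m≤d = ⊥-elim (¬orient₀ (O , or , λ u v → walk-≤ m≤d (diam u v)))
  ... | no m≰d  = ≰⇒> m≰d

_⁽²⁾ : Graph → Graph
G ⁽²⁾ = mult G (λ _ → 2)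

twin : ∀ {n} → Fin n → Fin 2
twin zero    = zero
twin (suc _) = suc zero

untwin : ∀ {n} → 2 ≤ n → Fin 2 → Fin n
untwin (s≤s (s≤s _)) zero    = zero
untwin (s≤s (s≤s _)) (suc _) = suc zero

twin-untwin : ∀ {n} (2≤n : 2 ≤ n) t → twin (untwin 2≤n t) ≡ t
twin-untwin (s≤s (s≤s _)) zero       = refl
twin-untwin (s≤s (s≤s _)) (suc zero) = refl

module _ {G : Graph} {s : V G → ℕ} where

  collapse : V (mult G s) → V (G ⁽²⁾)
  collapse (v , a) = v , twin a

  expand : (∀ v → 2 ≤ s v) → V (G ⁽²⁾) → V (mult G s)
  expand s≥2 (v , t) = v , untwin (s≥2 v) t

  collapse-expand : (s≥2 : ∀ v → 2 ≤ s v) → ∀ x → collapse (expand s≥2 x) ≡ x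
  collapse-expand s≥2 (v , t) = cong (v ,_) (twin-untwin (s≥2 v) t)

  isOrientation-on-collapse : {D : V (G ⁽²⁾) → V (G ⁽²⁾) → Set} →
    IsOrientation (G ⁽²⁾) D → IsOrientation (mult G s) (D on collapse)
  isOrientation-on-collapse (arc⇒edge , edge⇒arc , antisym) =
    (λ u v → arc⇒edge (collapse u) (collapse v)) ,
    (λ u v → edge⇒arc (collapse u) (collapse v)) ,
    (λ u v → antisym (collapse u) (collapse v))

  orientationWithin-mult : (∀ v → 2 ≤ s v) → {D : V (G ⁽²⁾) → V (G ⁽²⁾) → Set} →
    IsOrientation (G ⁽²⁾) D → DiamLE D (suc m) → ReturnsWithin D m →
    OrientationWithin (mult G s) (suc m)
  orientationWithin-mult s≥2 {D} or diam ret =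
    (D on collapse) , isOrientation-on-collapse or ,
    diamLE-on collapse (expand s≥2) (collapse-expand s≥2) diam ret

-- Between the layers, ((false , x) , t) ⟶ ((true , x) , t) and ((true , x) , t) ⟶ ((false , x) , t′)
-- for t ≢ t′: the four twins over x in the two layers form a directed 4-cycle.
double : {G : Graph} → (V (G ⁽²⁾) → V (G ⁽²⁾) → Set) → V ((K₂ □ G) ⁽²⁾) → V ((K₂ □ G) ⁽²⁾) → Set
double D ((false , x) , t) ((false , y) , t′) = D (x , t) (y , t′)
double D ((true  , x) , t) ((true  , y) , t′) = D (x , t) (y , t′)
double D ((false , x) , t) ((true  , y) , t′) = x ≡ y × t ≡ t′
double D ((true  , x) , t) ((false , y) , t′) = x ≡ y × t ≢ t′

module _ {G : Graph} {D : V (G ⁽²⁾) → V (G ⁽²⁾) → Set} where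

  isOrientation-double : IsOrientation (G ⁽²⁾) D → IsOrientation ((K₂ □ G) ⁽²⁾) (double {G} D)
  isOrientation-double (arc⇒edge , edge⇒arc , antisym) = arc⇒edge′ , edge⇒arc′ , antisym′
    where
    in-layer-edge : ∀ b {x y} → x ≢ y × E G x y → (b , x) ≢ (b , y) × E (K₂ □ G) (b , x) (b , y)
    in-layer-edge b (x≢y , e) = (λ { refl → x≢y refl }) , inj₁ (refl , e)

    arc⇒edge′ : ∀ u v → double {G} D u v → E ((K₂ □ G) ⁽²⁾) u v
    arc⇒edge′ ((false , x) , t) ((false , y) , t′) d = in-layer-edge false (arc⇒edge (x , t) (y , t′) d)
    arc⇒edge′ ((true  , x) , t) ((true  , y) , t′) d = in-layer-edge true (arc⇒edge (x , t) (y , t′) d)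
    arc⇒edge′ ((false , x) , t) ((true  , y) , t′) (refl , _) = (λ ()) , inj₂ ((λ ()) , refl)
    arc⇒edge′ ((true  , x) , t) ((false , y) , t′) (refl , _) = (λ ()) , inj₂ ((λ ()) , refl)

    edge⇒arc′ : ∀ u v → E ((K₂ □ G) ⁽²⁾) u v → double {G} D u v ⊎ double {G} D v u
    edge⇒arc′ ((false , x) , t) ((false , y) , t′) (u≢v , inj₁ (_ , e)) =
      edge⇒arc (x , t) (y , t′) ((λ { refl → u≢v refl }) , e)
    edge⇒arc′ ((true  , x) , t) ((true  , y) , t′) (u≢v , inj₁ (_ , e)) =
      edge⇒arc (x , t) (y , t′) ((λ { refl → u≢v refl }) , e)
    edge⇒arc′ ((false , x) , t) ((false , y) , t′) (_ , inj₂ (b≢b , _)) = ⊥-elim (b≢b refl)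
    edge⇒arc′ ((true  , x) , t) ((true  , y) , t′) (_ , inj₂ (b≢b , _)) = ⊥-elim (b≢b refl)
    edge⇒arc′ ((false , x) , t) ((true  , y) , t′) (_ , inj₂ (_ , refl)) with t Fin.≟ t′
    ... | yes t≡t′ = inj₁ (refl , t≡t′)
    ... | no  t≢t′ = inj₂ (refl , t≢t′ ∘ sym)
    edge⇒arc′ ((true  , x) , t) ((false , y) , t′) (_ , inj₂ (_ , refl)) with t Fin.≟ t′
    ... | yes t≡t′ = inj₂ (refl , sym t≡t′)
    ... | no  t≢t′ = inj₁ (refl , t≢t′)

    antisym′ : ∀ u v → ¬ (double {G} D u v × double {G} D v u)
    antisym′ ((false , x) , t) ((false , y) , t′) = antisym (x , t) (y , t′)
    antisym′ ((true  , x) , t) ((true  , y) , t′) = antisym (x , t) (y , t′)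
    antisym′ ((false , x) , t) ((true  , y) , t′) ((_ , t≡t′) , (_ , t′≢t)) = t′≢t (sym t≡t′)
    antisym′ ((true  , x) , t) ((false , y) , t′) ((_ , t≢t′) , (_ , t′≡t)) = t≢t′ (sym t′≡t)

  private
    layer-walk : ∀ b {x y : V G} {t t′ : Fin 2} →
                 Walk D k (x , t) (y , t′) → Walk (double {G} D) k ((b , x) , t) ((b , y) , t′)
    layer-walk false = walk-map (λ (x , t) → (false , x) , t) (λ d → d)
    layer-walk true  = walk-map (λ (x , t) → (true , x) , t) (λ d → d)

    other : Fin 2 → Fin 2
    other zero    = suc zero
    other (suc _) = zero

    ≢other : ∀ t → t ≢ other t
    ≢other zero       ()
    ≢other (suc zero) ()

  diamLE-double : DiamLE D k → DiamLE (double {G} D) (suc k)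
  diamLE-double {k} diam ((false , x) , t) ((false , y) , t′) = walk-≤ (n≤1+n k) (layer-walk false (diam _ _))
  diamLE-double {k} diam ((true  , x) , t) ((true  , y) , t′) = walk-≤ (n≤1+n k) (layer-walk true (diam _ _))
  diamLE-double diam ((false , x) , t) ((true  , y) , t′) = step (refl , refl) (layer-walk true (diam _ _))
  diamLE-double diam ((true  , x) , t) ((false , y) , t′) =
    step {w = (false , x) , other t} (refl , ≢other t) (layer-walk false (diam _ _))

  returnsWithin-double : ReturnsWithin (double {G} D) 3
  returnsWithin-double ((false , x) , t) =
    ((true , x) , t) , (refl , refl) ,
    step {w = (false , x) , other t} (refl , ≢other t)
      (step {w = (true , x) , other t} (refl , refl) (step (refl , ≢other t ∘ sym) here))
  returnsWithin-double ((true , x) , t) =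
    ((false , x) , other t) , (refl , ≢other t) ,
    step {w = (true , x) , other t} (refl , refl)
      (step {w = (false , x) , t} (refl , ≢other t ∘ sym) (step (refl , refl) here))

vertex-number : V (Q 3 ⁽²⁾) → ℕ
vertex-number ((b₁ , b₂ , b₃ , _) , t) = 2 * (bit b₁ + 2 * bit b₂ + 4 * bit b₃) + toℕ t
  where
  bit : Bool → ℕ
  bit false = 0
  bit true  = 1

Q₃-arcs : List (ℕ × ℕ)
Q₃-arcs =
  (0 , 2) ∷ (0 , 3) ∷ (1 , 2) ∷ (1 , 3) ∷ (0 , 4) ∷ (5 , 0) ∷ (4 , 1) ∷ (1 , 5) ∷
  (8 , 0) ∷ (0 , 9) ∷ (1 , 8) ∷ (9 , 1) ∷ (2 , 6) ∷ (2 , 7) ∷ (3 , 6) ∷ (3 , 7) ∷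
  (2 , 10) ∷ (11 , 2) ∷ (10 , 3) ∷ (3 , 11) ∷ (6 , 4) ∷ (7 , 4) ∷ (6 , 5) ∷ (7 , 5) ∷
  (12 , 4) ∷ (4 , 13) ∷ (5 , 12) ∷ (13 , 5) ∷ (14 , 6) ∷ (6 , 15) ∷ (7 , 14) ∷ (15 , 7) ∷
  (10 , 8) ∷ (11 , 8) ∷ (10 , 9) ∷ (11 , 9) ∷ (12 , 8) ∷ (8 , 13) ∷ (9 , 12) ∷ (13 , 9) ∷
  (14 , 10) ∷ (15 , 10) ∷ (14 , 11) ∷ (15 , 11) ∷ (12 , 14) ∷ (12 , 15) ∷ (13 , 14) ∷ (13 , 15) ∷ []

D₃ : V (Q 3 ⁽²⁾) → V (Q 3 ⁽²⁾) → Set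
D₃ u v = T (any (λ (a , b) → (vertex-number u ≡ᵇ a) ∧ (vertex-number v ≡ᵇ b)) Q₃-arcs)

D₃? : Decidable D₃
D₃? u v = Bool.T? _

finite-Q₃⁽²⁾ : Finite (V (Q 3 ⁽²⁾))
finite-Q₃⁽²⁾ = finite-mult {Q 3} (finite-Q 3)

D₃-isOrientation : IsOrientation (Q 3 ⁽²⁾) D₃
D₃-isOrientation =
  toWitness {a? = isOrientation? (E-mult? {Q 3} (finite-Q 3) (E-Q? 3)) finite-Q₃⁽²⁾ D₃?} tt

D₃-diamLE : DiamLE D₃ 3
D₃-diamLE = toWitness {a? = diamLE? finite-Q₃⁽²⁾ D₃? 3} tt

D₃-returnsWithin : ReturnsWithin D₃ 3
D₃-returnsWithin = toWitness {a? = returnsWithin? finite-Q₃⁽²⁾ D₃? 3} tt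

Q-orientation : ∀ k → V (Q (3 + k) ⁽²⁾) → V (Q (3 + k) ⁽²⁾) → Set
Q-orientation zero    = D₃
Q-orientation (suc k) = double {Q (3 + k)} (Q-orientation k)

Q-orientation-isOrientation : ∀ k → IsOrientation (Q (3 + k) ⁽²⁾) (Q-orientation k)
Q-orientation-isOrientation zero    = D₃-isOrientation
Q-orientation-isOrientation (suc k) = isOrientation-double (Q-orientation-isOrientation k)

Q-orientation-diamLE : ∀ k → DiamLE (Q-orientation k) (3 + k)
Q-orientation-diamLE zero    = D₃-diamLE
Q-orientation-diamLE (suc k) = diamLE-double (Q-orientation-diamLE k)

proposition1p9 :
    (InClass 0 (Q 3) (λ _ → 2)
      × (∀ (s : V (Q 3) → ℕ) → (∀ v → 2 ≤ s v) →
          InClass 0 (Q 3) s ⊎ InClass 1 (Q 3) s))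
    × (∀ (l : ℕ) → 4 ≤ l → ∀ (s : V (Q l) → ℕ) → (∀ v → 2 ≤ s v) →
          InClass 0 (Q l) s)
proposition1p9 = (Q₃⁽²⁾∈𝒞₀ , Q₃⁽ˢ⁾∈𝒞₀⊎𝒞₁) , Qₗ⁽ˢ⁾∈𝒞₀
  where
  Q₃⁽²⁾∈𝒞₀ : InClass 0 (Q 3) (λ _ → 2)
  Q₃⁽²⁾∈𝒞₀ = inClass₀ (Q-isDiameter 3) (λ _ → ≤-refl) (D₃ , D₃-isOrientation , D₃-diamLE)

  Q₃⁽ˢ⁾∈𝒞₀⊎𝒞₁ : ∀ s → (∀ v → 2 ≤ s v) → InClass 0 (Q 3) s ⊎ InClass 1 (Q 3) s
  Q₃⁽ˢ⁾∈𝒞₀⊎𝒞₁ s s≥2 = inClass₀⊎inClass₁ (finite-Q 3) (E-Q? 3) (Q-isDiameter 3) s≥2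
    (orientationWithin-mult s≥2 D₃-isOrientation (λ u v → walk-≤ (n≤1+n 3) (D₃-diamLE u v))
      D₃-returnsWithin)

  Qₗ⁽ˢ⁾∈𝒞₀ : ∀ l → 4 ≤ l → ∀ s → (∀ v → 2 ≤ s v) → InClass 0 (Q l) s
  Qₗ⁽ˢ⁾∈𝒞₀ (suc (suc (suc (suc k)))) (s≤s (s≤s (s≤s (s≤s _)))) s s≥2 =
    inClass₀ (Q-isDiameter (4 + k)) s≥2
      (orientationWithin-mult s≥2 (Q-orientation-isOrientation (suc k)) (Q-orientation-diamLE (suc k))
        (returnsWithin-≤ (m≤m+n 3 k) returnsWithin-double))
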